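{- Let $P$ be a point set and let $\Gamma$ be a binary point-set predicate with codomain $\{ -1,1\}$ such that $\Gamma$ is locally consistent on $P$ and $\Gamma_P(a,b)=-\Gamma_P(b,a)$ for every $(a,b)\in(P)_2$. Then $P$ is a wheel set.
   Context: Let $\mathcal P$ be the family of finite planar point sets in general position (no three collinear) with distinct $x$-coordinates; $P\in\mathcal P$. $\Delta_P\colon (P)_3\to\{ -1,1\}$ gives $1$ if the ordered triple is counterclockwise and $-1$ otherwise; $(X)_p$ denotes ordered $p$-tuples of distinct elements. A binary point-set predicate with codomain $Z$ is a function $\Gamma$ assigning to each $P\in\mathcal P$ and each $(p,q)\in(P)_2$ a value $\Gamma_P(p,q)\in Z$. $\Gamma$ is locally consistent on $P$ if for any two distinct subsets $\{a_1,a_2,a_3\}$, $\{b_1,b_2,b_3\}$ of $P$, $\Gamma_P(a_i,a_j)=\Gamma_P(b_i,b_j)$ for all distinct $i,j\in\{1,2,3\}$ implies $\Delta_P(a_1,a_2,a_3)=\Delta_P(b_1,b_2,b_3)$. A wheel set is a point set $P$ with at least $|P|-1$ extremal points (vertices of its convex hull).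
   Formalization: The point sets of $\mathcal P$, and so the point set P, have rational coordinates. -}

module Defs where

open import Data.Nat using (ℕ; zero; suc; _∸_) renaming (_≤_ to _≤ℕ_)
open import Data.Fin using (Fin; zero; suc)
open import Data.Product using (_×_; _,_; proj₁; proj₂; Σ; ∃)
open import Data.Rational using (ℚ; 0ℚ; 1ℚ; _+_; _*_; _-_; _≤_; _<_)
open import Data.Rational.Properties using (_<?_)
open import Data.Sign using (Sign) renaming (- to minus; + to plus)
open import Data.List using (List; length)
open import Data.List.Relation.Unary.All using (All)
open import Data.List.Relation.Unary.Unique.Propositional using (Unique)
open import Relation.Nullary using (¬_; does)
open import Relation.Binary.PropositionalEquality using (_≡_; _≢_)
open import Data.Bool using (if_then_else_)

Point : Set
Point = ℚ × ℚ

-- Twice the signed area of the triangle (a, b, c).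
det : Point → Point → Point → ℚ
det (ax , ay) (bx , by) (cx , cy) = ((bx - ax) * (cy - ay)) - ((by - ay) * (cx - ax))

record PointSet : Set where
  field
    n        : ℕ
    pt       : Fin n → Point
    distinctX : ∀ i j → i ≢ j → proj₁ (pt i) ≢ proj₁ (pt j)
    generalPosition : ∀ i j k → i ≢ j → j ≢ k → i ≢ k →
                      det (pt i) (pt j) (pt k) ≢ 0ℚ
open PointSet public

Δ : (P : PointSet) → Fin (n P) → Fin (n P) → Fin (n P) → Sign
Δ P i j k = if does (0ℚ <? det (pt P i) (pt P j) (pt P k)) then plus else minus

-- A binary point-set predicate with codomain {-1,1}, restricted to P:
-- a value Γ a b for every ordered pair (a , b) of distinct points of P
-- (values on the diagonal are irrelevant: every hypothesis only uses distinct pairs).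
BinPred : PointSet → Set
BinPred P = Fin (n P) → Fin (n P) → Sign

Distinct3 : ∀ {m} → Fin m → Fin m → Fin m → Set
Distinct3 a₁ a₂ a₃ = (a₁ ≢ a₂) × (a₂ ≢ a₃) × (a₁ ≢ a₃)

_∈₃_ : ∀ {m} → Fin m → (Fin m × Fin m × Fin m) → Set
x ∈₃ (a₁ , a₂ , a₃) = (x ≡ a₁) Data.Sum.⊎ ((x ≡ a₂) Data.Sum.⊎ (x ≡ a₃))
  where import Data.Sum

SameSet : ∀ {m} → (Fin m × Fin m × Fin m) → (Fin m × Fin m × Fin m) → Set
SameSet A B = (∀ x → x ∈₃ A → x ∈₃ B) × (∀ x → x ∈₃ B → x ∈₃ A)

LocallyConsistent : (P : PointSet) → BinPred P → Set
LocallyConsistent P Γ =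
  ∀ a₁ a₂ a₃ b₁ b₂ b₃ →
  Distinct3 a₁ a₂ a₃ → Distinct3 b₁ b₂ b₃ →
  ¬ SameSet (a₁ , a₂ , a₃) (b₁ , b₂ , b₃) →
  Γ a₁ a₂ ≡ Γ b₁ b₂ → Γ a₂ a₁ ≡ Γ b₂ b₁ →
  Γ a₁ a₃ ≡ Γ b₁ b₃ → Γ a₃ a₁ ≡ Γ b₃ b₁ →
  Γ a₂ a₃ ≡ Γ b₂ b₃ → Γ a₃ a₂ ≡ Γ b₃ b₂ →
  Δ P a₁ a₂ a₃ ≡ Δ P b₁ b₂ b₃

Antisymmetric : (P : PointSet) → BinPred P → Set
Antisymmetric P Γ = ∀ a b → a ≢ b → Γ a b ≡ Data.Sign.opposite (Γ b a)
  where import Data.Sign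

∑ : ∀ m → (Fin m → ℚ) → ℚ
∑ zero    f = 0ℚ
∑ (suc m) f = f zero + ∑ m (λ i → f (suc i))

-- pt p lies in the convex hull of P ∖ {p}: it is a convex combination
-- (nonnegative rational weights summing to 1) of the other points.
InHullOfOthers : (P : PointSet) → Fin (n P) → Set
InHullOfOthers P p =
  Σ (Fin (n P) → ℚ) λ w →
    (∀ i → 0ℚ ≤ w i) × (w p ≡ 0ℚ) × (∑ (n P) w ≡ 1ℚ) ×
    (∑ (n P) (λ i → w i * proj₁ (pt P i)) ≡ proj₁ (pt P p)) ×
    (∑ (n P) (λ i → w i * proj₂ (pt P i)) ≡ proj₂ (pt P p))

Extremal : (P : PointSet) → Fin (n P) → Set
Extremal P p = ¬ InHullOfOthers P p

-- P is a wheel set: it has at least |P| - 1 extremal points, i.e. there is a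
-- duplicate-free list of extremal points of length ≥ |P| - 1.
WheelSet : PointSet → Set
WheelSet P = Σ (List (Fin (n P))) λ S →
  Unique S × All (Extremal P) S × (n P ∸ 1 ≤ℕ length S)

{-# OPTIONS --safe #-}
module Submission where

open import Defs
open import Data.Nat using (zero; suc; _∸_) renaming (_≤_ to _≤ℕ_)
import Data.Nat.Properties as ℕ
open import Data.Rational
  using (ℚ; 0ℚ; 1ℚ; _+_; _*_; _-_; -_; _≤_; _<_; positive; negative; nonNegative; nonPositive)
open import Data.Rational.Properties
  using ( _<?_; _≟_; <-cmp; <-asym; <-irrefl; ≤-refl; ≤-antisym; ≮⇒≥; neg-antimono-<
        ; +-identityˡ; +-identityʳ; +-mono-<; +-mono-≤; +-monoˡ-≤; +-monoʳ-≤
        ; *-identityˡ; *-identityʳ; *-zeroˡ; *-zeroʳ; *-cancelˡ-<-nonNeg; 1≢0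
        ; pos⇒nonNeg; positive⁻¹; negative⁻¹; nonPositive⁻¹
        ; pos*pos⇒pos; pos*neg⇒neg; neg*pos⇒neg; neg*neg⇒pos; nonNeg*nonPos⇒nonPos )
open import Data.Rational.Solver using (module +-*-Solver)
open import Data.Sign using (Sign; opposite) renaming (- to minus; + to plus; _*_ to _⊛_)
import Data.Sign.Properties as Sign
open import Data.Bool using (Bool; true; false; if_then_else_)
import Data.Bool.Properties as Bool
open import Data.Fin using (Fin; punchIn)
import Data.Fin.Properties as Fin
open import Data.Empty using (⊥; ⊥-elim)
open import Data.Sum using (inj₁; inj₂; [_,_]′)
open import Data.Product using (_×_; _,_; proj₁; proj₂; Σ; ∃-syntax)
open import Data.List using (List; []; _∷_; allFin; tabulate; length)
open import Data.List.Properties using (length-tabulate)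
open import Data.List.Relation.Unary.Any using (here; there)
open import Data.List.Relation.Unary.All using (All)
import Data.List.Relation.Unary.All.Properties as All
open import Data.List.Relation.Unary.Unique.Propositional using (Unique)
import Data.List.Relation.Unary.Unique.Propositional.Properties as Unique
open import Data.List.Membership.Propositional using (_∈_)
open import Data.List.Membership.Propositional.Properties using (∈-allFin)
open import Function using (_∘_)
open import Relation.Nullary using (¬_; Dec; yes; no; does; ¬?)
open import Relation.Nullary.Decidable using (from-yes; map′; _×-dec_; _⊎-dec_; _→-dec_)
open import Relation.Binary.Definitions using (tri<; tri≈; tri>)
open import Relation.Binary.PropositionalEquality
  using (_≡_; _≢_; refl; sym; trans; cong; cong₂; subst; subst₂; ≢-sym; module ≡-Reasoning)
open +-*-Solver

-- Antisymmetry makes Γ a tournament. Reading a triangle along the majority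
-- direction of its three arcs gives an orientation Δₘ that depends only on the
-- unordered triple, and local consistency says that it depends only on whether
-- the triangle is cyclic. A non-extremal point p lies inside a triangle r x z of
-- other points. Comparing the four triangles p r x, p x z, p z r and r x z (a
-- finite check over the signs of their six arcs) shows that the spokes p r, p x,
-- p z point the same way, and then so does every other arc at p: otherwise its
-- endpoint would lie on the same side of all three spokes. Hence an interior point
-- is a source or a sink. If p and q were both interior, all triangles q a p would
-- carry the same arcs, so all other points would lie on one side of the line q p,
-- which is impossible for a point q inside a triangle.

HasSign : Sign → ℚ → Set
HasSign plus  d = 0ℚ < d
HasSign minus d = d < 0ℚ

hasSign? : ∀ s d → Dec (HasSign s d)
hasSign? plus  d = 0ℚ <? d
hasSign? minus d = d <? 0ℚ

-- Δ P i j k unfolds to signOf of the determinant; the junk value at 0 is minus.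
signOf : ℚ → Sign
signOf d = if does (0ℚ <? d) then plus else minus

signOf-elim : (X : Sign → Set) (d : ℚ) →
              (0ℚ < d → X plus) → (¬ 0ℚ < d → X minus) → X (signOf d)
signOf-elim X d = elim (0ℚ <? d)
  where
  elim : (0<d? : Dec (0ℚ < d)) → (0ℚ < d → X plus) → (¬ 0ℚ < d → X minus) →
         X (if does 0<d? then plus else minus)
  elim (yes 0<d) pos _   = pos 0<d
  elim (no 0≮d)  _   neg = neg 0≮d

≢0∧≯0⇒<0 : ∀ {d} → d ≢ 0ℚ → ¬ 0ℚ < d → d < 0ℚ
≢0∧≯0⇒<0 {d} d≢0 0≮d with <-cmp d 0ℚ
... | tri< d<0 _ _ = d<0
... | tri≈ _ d≡0 _ = ⊥-elim (d≢0 d≡0)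
... | tri> _ _ 0<d = ⊥-elim (0≮d 0<d)

hasSign-signOf : ∀ {d} → d ≢ 0ℚ → HasSign (signOf d) d
hasSign-signOf {d} d≢0 = signOf-elim (λ s → HasSign s d) d (λ 0<d → 0<d) (≢0∧≯0⇒<0 d≢0)

signOf-hasSign : ∀ s {d} → HasSign s d → signOf d ≡ s
signOf-hasSign plus  {d} 0<d = signOf-elim (_≡ plus) d (λ _ → refl) (λ 0≮d → ⊥-elim (0≮d 0<d))
signOf-hasSign minus {d} d<0 = signOf-elim (_≡ minus) d (λ 0<d → ⊥-elim (<-asym d<0 0<d)) (λ _ → refl)

¬hasSign-0 : ∀ s → ¬ HasSign s 0ℚ
¬hasSign-0 plus  = <-irrefl refl
¬hasSign-0 minus = <-irrefl refl

hasSign-neg : ∀ s {d} → HasSign s d → HasSign (opposite s) (- d)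
hasSign-neg plus  = neg-antimono-<
hasSign-neg minus = neg-antimono-<

hasSign-+ : ∀ s {d e} → HasSign s d → HasSign s e → HasSign s (d + e)
hasSign-+ plus  {d} {e} 0<d 0<e = subst (_< d + e) (+-identityʳ 0ℚ) (+-mono-< 0<d 0<e)
hasSign-+ minus {d} {e} d<0 e<0 = subst (d + e <_) (+-identityʳ 0ℚ) (+-mono-< d<0 e<0)

hasSign-* : ∀ s t {d e} → HasSign s d → HasSign t e → HasSign (s ⊛ t) (d * e)
hasSign-* plus  plus  {d} {e} 0<d 0<e =
  positive⁻¹ (d * e) {{pos*pos⇒pos d {{positive 0<d}} e {{positive 0<e}}}}
hasSign-* plus  minus {d} {e} 0<d e<0 =
  negative⁻¹ (d * e) {{pos*neg⇒neg d {{positive 0<d}} e {{negative e<0}}}}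
hasSign-* minus plus  {d} {e} d<0 0<e =
  negative⁻¹ (d * e) {{neg*pos⇒neg d {{negative d<0}} e {{positive 0<e}}}}
hasSign-* minus minus {d} {e} d<0 e<0 =
  positive⁻¹ (d * e) {{neg*neg⇒pos d {{negative d<0}} e {{negative e<0}}}}

*≡0⇒≡0 : ∀ {a b} → a * b ≡ 0ℚ → b ≢ 0ℚ → a ≡ 0ℚ
*≡0⇒≡0 {a} {b} ab≡0 b≢0 with a ≟ 0ℚ
... | yes a≡0 = a≡0
... | no  a≢0 = ⊥-elim (¬hasSign-0 _ (subst (HasSign _) ab≡0
                  (hasSign-* _ _ (hasSign-signOf a≢0) (hasSign-signOf b≢0))))

-- Determinant identities

det-rotate : ∀ a b c → det b c a ≡ det a b c
det-rotate (ax , ay) (bx , by) (cx , cy) =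
  solve 6 (λ ax ay bx by cx cy →
    ((cx :- bx) :* (ay :- by)) :- ((cy :- by) :* (ax :- bx))
    := ((bx :- ax) :* (cy :- ay)) :- ((by :- ay) :* (cx :- ax))) refl ax ay bx by cx cy

det-swap₂₃ : ∀ a b c → det a c b ≡ - det a b c
det-swap₂₃ (ax , ay) (bx , by) (cx , cy) =
  solve 6 (λ ax ay bx by cx cy →
    ((cx :- ax) :* (by :- ay)) :- ((cy :- ay) :* (bx :- ax))
    := :- (((bx :- ax) :* (cy :- ay)) :- ((by :- ay) :* (cx :- ax)))) refl ax ay bx by cx cy

det-repeat₁₂ : ∀ a c → det a a c ≡ 0ℚ
det-repeat₁₂ (ax , ay) (cx , cy) =
  solve 4 (λ ax ay cx cy →
    ((ax :- ax) :* (cy :- ay)) :- ((ay :- ay) :* (cx :- ax)) := con 0ℚ) refl ax ay cx cy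

det-repeat₂₃ : ∀ a b → det a b b ≡ 0ℚ
det-repeat₂₃ (ax , ay) (bx , by) =
  solve 4 (λ ax ay bx by →
    ((bx :- ax) :* (by :- ay)) :- ((by :- ay) :* (bx :- ax)) := con 0ℚ) refl ax ay bx by

det-repeat₁₃ : ∀ a b → det a b a ≡ 0ℚ
det-repeat₁₃ (ax , ay) (bx , by) =
  solve 4 (λ ax ay bx by →
    ((bx :- ax) :* (ay :- ay)) :- ((by :- ay) :* (ax :- ax)) := con 0ℚ) refl ax ay bx by

det-decompose : ∀ p r x z → det r x z ≡ det p r x + det p x z + det p z r
det-decompose (px , py) (rx , ry) (xx , xy) (zx , zy) =
  solve 8 (λ px py rx ry xx xy zx zy →
    ((xx :- rx) :* (zy :- ry)) :- ((xy :- ry) :* (zx :- rx))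
    := (((rx :- px) :* (xy :- py)) :- ((ry :- py) :* (xx :- px)))
     :+ (((xx :- px) :* (zy :- py)) :- ((xy :- py) :* (zx :- px)))
     :+ (((zx :- px) :* (ry :- py)) :- ((zy :- py) :* (rx :- px)))) refl px py rx ry xx xy zx zy

-- With u = r - p, v = x - p, w = z - p: three plane vectors satisfy
-- [v,w] u + [w,u] v + [u,v] w = 0; here paired with b - p.
det-dependence : ∀ p r x z b →
  det p x z * det p r b + det p z r * det p x b + det p r x * det p z b ≡ 0ℚ
det-dependence (px , py) (rx , ry) (xx , xy) (zx , zy) (bx , by) =
  solve 8 (λ r₁ r₂ x₁ x₂ z₁ z₂ b₁ b₂ →
     ((x₁ :* z₂) :- (x₂ :* z₁)) :* ((r₁ :* b₂) :- (r₂ :* b₁))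
     :+ ((z₁ :* r₂) :- (z₂ :* r₁)) :* ((x₁ :* b₂) :- (x₂ :* b₁))
     :+ ((r₁ :* x₂) :- (r₂ :* x₁)) :* ((z₁ :* b₂) :- (z₂ :* b₁)) := con 0ℚ) refl
     (rx - px) (ry - py) (xx - px) (xy - py) (zx - px) (zy - py) (bx - px) (by - py)

det-plücker : ∀ p r a b c →
  det p r b * det p a c ≡ det p r a * det p b c + det p r c * det p a b
det-plücker (px , py) (rx , ry) (ax , ay) (bx , by) (cx , cy) =
  solve 8 (λ r₁ r₂ a₁ a₂ b₁ b₂ c₁ c₂ →
     ((r₁ :* b₂) :- (r₂ :* b₁)) :* ((a₁ :* c₂) :- (a₂ :* c₁))
     := ((r₁ :* a₂) :- (r₂ :* a₁)) :* ((b₁ :* c₂) :- (b₂ :* c₁))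
      :+ ((r₁ :* c₂) :- (r₂ :* c₁)) :* ((a₁ :* b₂) :- (a₂ :* b₁))) refl
     (rx - px) (ry - py) (ax - px) (ay - py) (bx - px) (by - py) (cx - px) (cy - py)

det-affine : ∀ p r → ∃[ A ] ∃[ B ] ∃[ C ] ∀ q → det p r q ≡ A * proj₁ q + B * proj₂ q + C
det-affine (px , py) (rx , ry) =
  - (ry - py) , rx - px , (ry - py) * px - (rx - px) * py , λ { (qx , qy) →
    solve 6 (λ px py rx ry qx qy →
      ((rx :- px) :* (qy :- py)) :- ((ry :- py) :* (qx :- px))
      := (:- (ry :- py)) :* qx :+ (rx :- px) :* qy :+ ((ry :- py) :* px :- (rx :- px) :* py))
      refl px py rx ry qx qy }

-- Points inside a triangle

hasSign-swap₂₃ : ∀ a b c {s} → HasSign s (det a b c) → HasSign (opposite s) (det a c b)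
hasSign-swap₂₃ a b c {s} h = subst (HasSign (opposite s)) (sym (det-swap₂₃ a b c)) (hasSign-neg s h)

record Inside (p r x z : Point) : Set where
  constructor inside
  field
    orientation : Sign
    prx : HasSign orientation (det p r x)
    pxz : HasSign orientation (det p x z)
    pzr : HasSign orientation (det p z r)

inside? : ∀ p r x z → Dec (Inside p r x z)
inside? p r x z = map′
  (λ { (inj₁ (h₁ , h₂ , h₃)) → inside plus h₁ h₂ h₃ ; (inj₂ (h₁ , h₂ , h₃)) → inside minus h₁ h₂ h₃ })
  (λ { (inside plus h₁ h₂ h₃) → inj₁ (h₁ , h₂ , h₃) ; (inside minus h₁ h₂ h₃) → inj₂ (h₁ , h₂ , h₃) })
  (oriented plus ⊎-dec oriented minus)
  where
  oriented : ∀ ε → Dec (HasSign ε (det p r x) × HasSign ε (det p x z) × HasSign ε (det p z r))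
  oriented ε = hasSign? ε _ ×-dec hasSign? ε _ ×-dec hasSign? ε _

inside-rotate : ∀ {p r x z} → Inside p r x z → Inside p x z r
inside-rotate (inside ε prx pxz pzr) = inside ε pxz pzr prx

inside-outer : ∀ {p r x z} (ins : Inside p r x z) → HasSign (Inside.orientation ins) (det r x z)
inside-outer {p} {r} {x} {z} (inside ε prx pxz pzr) =
  subst (HasSign ε) (sym (det-decompose p r x z)) (hasSign-+ ε (hasSign-+ ε prx pxz) pzr)

inside-no-half-plane : ∀ {p r x z b} → Inside p r x z → ∀ σ →
  HasSign σ (det p r b) → HasSign σ (det p x b) → HasSign σ (det p z b) → ⊥
inside-no-half-plane {p} {r} {x} {z} {b} (inside ε prx pxz pzr) σ prb pxb pzb =
  ¬hasSign-0 (ε ⊛ σ) (subst (HasSign (ε ⊛ σ)) (det-dependence p r x z b)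
    (hasSign-+ _ (hasSign-+ _ (hasSign-* ε σ pxz prb) (hasSign-* ε σ pzr pxb)) (hasSign-* ε σ prx pzb)))

left-turn-trans : ∀ {p r a b c} → 0ℚ < det p r a → 0ℚ < det p r b → 0ℚ < det p r c →
                  0ℚ < det p a b → 0ℚ < det p b c → 0ℚ < det p a c
left-turn-trans {p} {r} {a} {b} {c} ra rb rc ab bc =
  *-cancelˡ-<-nonNeg (det p r b) {{pos⇒nonNeg (det p r b) {{positive rb}}}}
    (subst₂ _<_ (sym (*-zeroʳ (det p r b))) (sym (det-plücker p r a b c))
      (hasSign-+ plus (hasSign-* plus plus ra bc) (hasSign-* plus plus rc ab)))

∑-cong : ∀ m {f g : Fin m → ℚ} → (∀ i → f i ≡ g i) → ∑ m f ≡ ∑ m g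
∑-cong zero    f≗g = refl
∑-cong (suc m) f≗g = cong₂ _+_ (f≗g Fin.zero) (∑-cong m (λ i → f≗g (Fin.suc i)))

∑-affine : ∀ m (w x y : Fin m → ℚ) A B C →
  ∑ m (λ i → w i * (A * x i + B * y i + C)) ≡
  A * ∑ m (λ i → w i * x i) + B * ∑ m (λ i → w i * y i) + C * ∑ m w
∑-affine zero w x y A B C =
  solve 3 (λ A B C → con 0ℚ := A :* con 0ℚ :+ B :* con 0ℚ :+ C :* con 0ℚ) refl A B C
∑-affine (suc m) w x y A B C
  rewrite ∑-affine m (λ i → w (Fin.suc i)) (λ i → x (Fin.suc i)) (λ i → y (Fin.suc i)) A B C =
  solve 9 (λ w₀ x₀ y₀ A B C Sx Sy S →
     w₀ :* (A :* x₀ :+ B :* y₀ :+ C) :+ (A :* Sx :+ B :* Sy :+ C :* S)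
     := A :* (w₀ :* x₀ :+ Sx) :+ B :* (w₀ :* y₀ :+ Sy) :+ C :* (w₀ :+ S)) refl
     (w Fin.zero) (x Fin.zero) (y Fin.zero) A B C
     (∑ m (λ i → w (Fin.suc i) * x (Fin.suc i))) (∑ m (λ i → w (Fin.suc i) * y (Fin.suc i)))
     (∑ m (λ i → w (Fin.suc i)))

∑-nonpos : ∀ m {f : Fin m → ℚ} → (∀ i → f i ≤ 0ℚ) → ∑ m f ≤ 0ℚ
∑-nonpos zero    f≤0 = ≤-refl
∑-nonpos (suc m) {f} f≤0 = subst (∑ (suc m) f ≤_) (+-identityʳ 0ℚ)
  (+-mono-≤ (f≤0 Fin.zero) (∑-nonpos m (λ i → f≤0 (Fin.suc i))))

+-nonpos-≡0 : ∀ {a b} → a ≤ 0ℚ → b ≤ 0ℚ → a + b ≡ 0ℚ → a ≡ 0ℚ × b ≡ 0ℚ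
+-nonpos-≡0 {a} {b} a≤0 b≤0 a+b≡0 =
  ≤-antisym a≤0 (subst₂ _≤_ a+b≡0 (+-identityʳ a) (+-monoʳ-≤ a b≤0)) ,
  ≤-antisym b≤0 (subst₂ _≤_ a+b≡0 (+-identityˡ b) (+-monoˡ-≤ b a≤0))

∑-nonpos-≡0 : ∀ m {f : Fin m → ℚ} → (∀ i → f i ≤ 0ℚ) → ∑ m f ≡ 0ℚ → ∀ i → f i ≡ 0ℚ
∑-nonpos-≡0 (suc m) f≤0 ∑≡0 i with +-nonpos-≡0 (f≤0 Fin.zero) (∑-nonpos m (λ j → f≤0 (Fin.suc j))) ∑≡0
∑-nonpos-≡0 (suc m) f≤0 ∑≡0 Fin.zero    | f₀≡0 , _    = f₀≡0
∑-nonpos-≡0 (suc m) f≤0 ∑≡0 (Fin.suc i) | _    , rest = ∑-nonpos-≡0 m (λ j → f≤0 (Fin.suc j)) rest i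

∑-zero : ∀ m {f : Fin m → ℚ} → (∀ i → f i ≡ 0ℚ) → ∑ m f ≡ 0ℚ
∑-zero zero    f≡0 = refl
∑-zero (suc m) f≡0 = trans (cong₂ _+_ (f≡0 Fin.zero) (∑-zero m (λ i → f≡0 (Fin.suc i)))) (+-identityʳ 0ℚ)

∑-single : ∀ m {f : Fin m → ℚ} o → (∀ i → i ≢ o → f i ≡ 0ℚ) → ∑ m f ≡ f o
∑-single (suc m) {f} Fin.zero    off-o =
  trans (cong (f Fin.zero +_) (∑-zero m (λ i → off-o (Fin.suc i) (λ ())))) (+-identityʳ _)
∑-single (suc m) {f} (Fin.suc o) off-o =
  trans (cong (_+ ∑ m (λ i → f (Fin.suc i))) (off-o Fin.zero (λ ())))
    (trans (+-identityˡ _) (∑-single m o (λ i i≢o → off-o (Fin.suc i) (i≢o ∘ Fin.suc-injective))))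

maximal : ∀ {A : Set} {L : A → Set} {_≺_ : A → A → Set} →
          (∀ a → Dec (L a)) → (∀ a b → Dec (a ≺ b)) →
          (∀ {a b c} → L a → L b → L c → a ≺ b → b ≺ c → a ≺ c) → (∀ {a} → ¬ a ≺ a) →
          ∀ {x₀} → L x₀ → (xs : List A) → ∃[ m ] L m × (∀ {y} → y ∈ xs → L y → ¬ m ≺ y)
maximal {A} {L} {_≺_} L? ≺? ≺-trans ≺-irrefl {x₀} Lx₀ = go
  where
  go : (xs : List A) → ∃[ m ] L m × (∀ {y} → y ∈ xs → L y → ¬ m ≺ y)
  go [] = x₀ , Lx₀ , λ ()
  go (y ∷ ys) with go ys
  ... | m , Lm , m-max with L? y | ≺? m y
  ...   | yes Ly | yes m≺y =
    y , Ly , λ { (here refl) _ → ≺-irrefl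
               ; (there y′∈ys) Ly′ y≺y′ → m-max y′∈ys Ly′ (≺-trans Lm Ly Ly′ m≺y y≺y′) }
  ...   | no ¬Ly | _       = m , Lm , λ { (here refl) Ly → ⊥-elim (¬Ly Ly) ; (there y′∈ys) → m-max y′∈ys }
  ...   | yes _  | no m⊀y  = m , Lm , λ { (here refl) _ → m⊀y ; (there y′∈ys) → m-max y′∈ys }

-- Arc patterns of a triangle

Pattern : Set
Pattern = Sign × Sign × Sign

majority : Pattern → Sign
majority (plus  , plus  , _) = plus
majority (minus , minus , _) = minus
majority (plus  , minus , c) = c
majority (minus , plus  , c) = c

cyclic : Pattern → Bool
cyclic (plus  , plus  , plus ) = true
cyclic (minus , minus , minus) = true
cyclic _                       = false

Coherent : Pattern → Pattern → Set
Coherent t t′ = cyclic t ≡ cyclic t′ → majority t ≡ majority t′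

coherent? : ∀ t t′ → Dec (Coherent t t′)
coherent? t t′ = (cyclic t Bool.≟ cyclic t′) →-dec (majority t Sign.≟ majority t′)

∀-sign? : {A : Sign → Set} → (∀ s → Dec (A s)) → Dec (∀ s → A s)
∀-sign? A? with A? plus | A? minus
... | yes a₊ | yes a₋ = yes λ { plus → a₊ ; minus → a₋ }
... | no ¬a₊ | _      = no λ a → ¬a₊ (a plus)
... | yes _  | no ¬a₋ = no λ a → ¬a₋ (a minus)

majority-rotate : ∀ x y z → majority (y , z , x) ≡ majority (x , y , z)
majority-rotate = from-yes (∀-sign? λ x → ∀-sign? λ y → ∀-sign? λ z →
  majority (y , z , x) Sign.≟ majority (x , y , z))

cyclic-rotate : ∀ x y z → cyclic (y , z , x) ≡ cyclic (x , y , z)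
cyclic-rotate = from-yes (∀-sign? λ x → ∀-sign? λ y → ∀-sign? λ z →
  cyclic (y , z , x) Bool.≟ cyclic (x , y , z))

majority-mirror : ∀ x y z →
  majority (opposite z , opposite y , opposite x) ≡ opposite (majority (x , y , z))
majority-mirror = from-yes (∀-sign? λ x → ∀-sign? λ y → ∀-sign? λ z →
  majority (opposite z , opposite y , opposite x) Sign.≟ opposite (majority (x , y , z)))

cyclic-mirror : ∀ x y z → cyclic (opposite z , opposite y , opposite x) ≡ cyclic (x , y , z)
cyclic-mirror = from-yes (∀-sign? λ x → ∀-sign? λ y → ∀-sign? λ z →
  cyclic (opposite z , opposite y , opposite x) Bool.≟ cyclic (x , y , z))

majority[s,t,s]≡s : ∀ s t → majority (s , t , s) ≡ s
majority[s,t,s]≡s plus  plus  = refl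
majority[s,t,s]≡s plus  minus = refl
majority[s,t,s]≡s minus plus  = refl
majority[s,t,s]≡s minus minus = refl

cyclic[s,t,-s]≡false : ∀ s t → cyclic (s , t , opposite s) ≡ false
cyclic[s,t,-s]≡false plus  plus  = refl
cyclic[s,t,-s]≡false plus  minus = refl
cyclic[s,t,-s]≡false minus plus  = refl
cyclic[s,t,-s]≡false minus minus = refl

cyclic[+,+,s]-injective : ∀ s t → cyclic (plus , plus , s) ≡ cyclic (plus , plus , t) → s ≡ t
cyclic[+,+,s]-injective plus  plus  _  = refl
cyclic[+,+,s]-injective plus  minus ()
cyclic[+,+,s]-injective minus plus  ()
cyclic[+,+,s]-injective minus minus _  = refl

s≢t⇒opposite[s]≡t : ∀ {s t} → s ≢ t → opposite s ≡ t
s≢t⇒opposite[s]≡t {plus}  {plus}  s≢t = ⊥-elim (s≢t refl)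
s≢t⇒opposite[s]≡t {plus}  {minus} _   = refl
s≢t⇒opposite[s]≡t {minus} {plus}  _   = refl
s≢t⇒opposite[s]≡t {minus} {minus} s≢t = ⊥-elim (s≢t refl)

opposite[s]⊛opposite[t]≡s⊛t : ∀ s t → opposite s ⊛ opposite t ≡ s ⊛ t
opposite[s]⊛opposite[t]≡s⊛t plus  t = Sign.opposite-involutive t
opposite[s]⊛opposite[t]≡s⊛t minus t = refl

-- The patterns of the triangles p r x, p x z, p z r and r x z when the spokes
-- p r, p x, p z carry a, b, c and the rim r x, x z, z r carries d, e, f.
wheel-patterns : ∀ a b c d e f →
  let t₁ = (a , d , opposite b) ; t₂ = (b , e , opposite c)
      t₃ = (c , f , opposite a) ; t₄ = (d , e , f) in
  Coherent t₁ t₂ × Coherent t₁ t₃ × Coherent t₁ t₄ × Coherent t₂ t₃ × Coherent t₂ t₄ × Coherent t₃ t₄ →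
  a ≡ b × b ≡ c × cyclic t₄ ≡ true × majority t₁ ≡ majority t₄
wheel-patterns = from-yes (∀-sign? λ a → ∀-sign? λ b → ∀-sign? λ c →
                           ∀-sign? λ d → ∀-sign? λ e → ∀-sign? λ f →
  let t₁ = (a , d , opposite b) ; t₂ = (b , e , opposite c)
      t₃ = (c , f , opposite a) ; t₄ = (d , e , f) in
  (coherent? t₁ t₂ ×-dec coherent? t₁ t₃ ×-dec coherent? t₁ t₄ ×-dec
   coherent? t₂ t₃ ×-dec coherent? t₂ t₄ ×-dec coherent? t₃ t₄) →-dec
  (a Sign.≟ b ×-dec b Sign.≟ c ×-dec cyclic t₄ Bool.≟ true ×-dec majority t₁ Sign.≟ majority t₄))

≢-rotate : ∀ {m} {a b c : Fin m} → Distinct3 a b c → Distinct3 b c a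
≢-rotate (a≢b , b≢c , a≢c) = b≢c , ≢-sym a≢c , ≢-sym a≢b

≢-swap : ∀ {m} {a b c : Fin m} → Distinct3 a b c → Distinct3 a c b
≢-swap (a≢b , b≢c , a≢c) = a≢c , ≢-sym b≢c , a≢b

sameSet-refl : ∀ {m} {A : Fin m × Fin m × Fin m} → SameSet A A
sameSet-refl = (λ _ x∈A → x∈A) , (λ _ x∈A → x∈A)

sameSet-sym : ∀ {m} {A B : Fin m × Fin m × Fin m} → SameSet A B → SameSet B A
sameSet-sym (A⊆B , B⊆A) = B⊆A , A⊆B

sameSet-trans : ∀ {m} {A B C : Fin m × Fin m × Fin m} → SameSet A B → SameSet B C → SameSet A C
sameSet-trans (A⊆B , B⊆A) (B⊆C , C⊆B) = (λ x → B⊆C x ∘ A⊆B x) , (λ x → B⊆A x ∘ C⊆B x)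

sameSet-rotate : ∀ {m} {a b c : Fin m} → SameSet (b , c , a) (a , b , c)
sameSet-rotate =
  (λ _ → [ inj₂ ∘ inj₁ , [ inj₂ ∘ inj₂ , inj₁ ]′ ]′) , (λ _ → [ inj₂ ∘ inj₂ , [ inj₁ , inj₂ ∘ inj₁ ]′ ]′)

sameSet-swap : ∀ {m} {a b c : Fin m} → SameSet (a , c , b) (a , b , c)
sameSet-swap =
  (λ _ → [ inj₁ , [ inj₂ ∘ inj₂ , inj₂ ∘ inj₁ ]′ ]′) , (λ _ → [ inj₁ , [ inj₂ ∘ inj₂ , inj₂ ∘ inj₁ ]′ ]′)

∉₃ : ∀ {m} {x a b c : Fin m} → x ≢ a → x ≢ b → x ≢ c → ¬ x ∈₃ (a , b , c)
∉₃ x≢a x≢b x≢c = [ x≢a , [ x≢b , x≢c ]′ ]′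

apart : ∀ {m} {x : Fin m} {A B} → x ∈₃ A → ¬ x ∈₃ B → ¬ SameSet A B
apart x∈A x∉B (A⊆B , _) = x∉B (A⊆B _ x∈A)

pattern at₁ = inj₁ refl
pattern at₂ = inj₂ (inj₁ refl)
pattern at₃ = inj₂ (inj₂ refl)

module Orientation (P : PointSet) where

  F : Set
  F = Fin (n P)

  D : F → F → F → ℚ
  D i j k = det (pt P i) (pt P j) (pt P k)

  hasSign⇒distinct : ∀ {s a b c} → HasSign s (D a b c) → Distinct3 a b c
  hasSign⇒distinct {s} {a} {b} {c} h =
    (λ { refl → ¬hasSign-0 s (subst (HasSign s) (det-repeat₁₂ (pt P a) (pt P c)) h) }) ,
    (λ { refl → ¬hasSign-0 s (subst (HasSign s) (det-repeat₂₃ (pt P a) (pt P b)) h) }) ,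
    (λ { refl → ¬hasSign-0 s (subst (HasSign s) (det-repeat₁₃ (pt P a) (pt P b)) h) })

  Δ-hasSign : ∀ {a b c} → Distinct3 a b c → HasSign (Δ P a b c) (D a b c)
  Δ-hasSign {a} {b} {c} (a≢b , b≢c , a≢c) = hasSign-signOf (generalPosition P a b c a≢b b≢c a≢c)

  Δ-rotate : ∀ a b c → Δ P b c a ≡ Δ P a b c
  Δ-rotate a b c = cong signOf (det-rotate (pt P a) (pt P b) (pt P c))

  Δ-swap : ∀ {a b c} → Distinct3 a b c → Δ P a c b ≡ opposite (Δ P a b c)
  Δ-swap {a} {b} {c} d = signOf-hasSign _ (hasSign-swap₂₃ (pt P a) (pt P b) (pt P c) (Δ-hasSign d))

  InTriangle : F → F → F → F → Set
  InTriangle p r x z = Inside (pt P p) (pt P r) (pt P x) (pt P z)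

  Interior : F → Set
  Interior p = ∃[ r ] ∃[ x ] ∃[ z ] InTriangle p r x z

  interior? : ∀ p → Dec (Interior p)
  interior? p = Fin.any? λ r → Fin.any? λ x → Fin.any? λ z → inside? _ _ _ _

  apex∉rim : ∀ {p r x z} → InTriangle p r x z → ¬ p ∈₃ (r , x , z)
  apex∉rim (inside _ prx pxz pzr) =
    ∉₃ (proj₁ (hasSign⇒distinct prx)) (proj₁ (hasSign⇒distinct pxz)) (proj₁ (hasSign⇒distinct pzr))

  rim∉ : ∀ {p r x z} → InTriangle p r x z → ¬ r ∈₃ (p , x , z)
  rim∉ (inside _ prx _ pzr) =
    ∉₃ (≢-sym (proj₁ (hasSign⇒distinct prx))) (proj₁ (proj₂ (hasSign⇒distinct prx)))
       (≢-sym (proj₁ (proj₂ (hasSign⇒distinct pzr))))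

  no-half-plane : ∀ {p r x z b} → InTriangle p r x z → p ≢ b → r ≢ b → x ≢ b → z ≢ b →
                  Δ P p r b ≡ Δ P p x b → Δ P p x b ≡ Δ P p z b → ⊥
  no-half-plane {p} {r} {x} {z} {b} ins p≢b r≢b x≢b z≢b Δr≡Δx Δx≡Δz =
    inside-no-half-plane {b = pt P b} ins _ (Δ-hasSign (apex∉rim ins ∘ inj₁ , r≢b , p≢b))
      (subst (λ s → HasSign s (D p x b)) (sym Δr≡Δx) (Δ-hasSign (apex∉rim ins ∘ inj₂ ∘ inj₁ , x≢b , p≢b)))
      (subst (λ s → HasSign s (D p z b)) (sym (trans Δr≡Δx Δx≡Δz))
             (Δ-hasSign (apex∉rim ins ∘ inj₂ ∘ inj₂ , z≢b , p≢b)))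

  AllOnOneSide : F → F → Set
  AllOnOneSide q p = ∀ a a′ → q ≢ a → a ≢ p → q ≢ a′ → a′ ≢ p → Δ P q a p ≡ Δ P q a′ p

  vertex-splits : ∀ {q p v w} → InTriangle q p v w → ¬ AllOnOneSide q p
  vertex-splits {q} {p} {v} {w} (inside ε qpv qvw qwp) one-sided =
    Sign.s≢opposite[s] ε (trans (sym Δqwp≡ε) (trans (sym (one-sided v w q≢v v≢p q≢w w≢p)) Δqvp≡-ε))
    where
    Δqvp≡-ε : Δ P q v p ≡ opposite ε
    Δqvp≡-ε = signOf-hasSign _ (hasSign-swap₂₃ (pt P q) (pt P p) (pt P v) qpv)
    Δqwp≡ε : Δ P q w p ≡ ε
    Δqwp≡ε = signOf-hasSign ε qwp
    q≢v = proj₂ (proj₂ (hasSign⇒distinct qpv))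
    v≢p = ≢-sym (proj₁ (proj₂ (hasSign⇒distinct qpv)))
    q≢w = proj₁ (hasSign⇒distinct qwp)
    w≢p = proj₁ (proj₂ (hasSign⇒distinct qwp))

  interior-splits : ∀ {q u v w p} → InTriangle q u v w → q ≢ p → ¬ AllOnOneSide q p
  interior-splits {q} {u} {v} {w} {p} ins q≢p one-sided
    with p Fin.≟ u | p Fin.≟ v | p Fin.≟ w
  ... | yes refl | _        | _        = vertex-splits ins one-sided
  ... | _        | yes refl | _        = vertex-splits (inside-rotate ins) one-sided
  ... | _        | _        | yes refl = vertex-splits (inside-rotate (inside-rotate ins)) one-sided
  ... | no p≢u   | no p≢v   | no p≢w   =
    no-half-plane ins q≢p (≢-sym p≢u) (≢-sym p≢v) (≢-sym p≢w)
      (one-sided u v q≢u (≢-sym p≢u) q≢v (≢-sym p≢v)) (one-sided v w q≢v (≢-sym p≢v) q≢w (≢-sym p≢w))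
    where
    q≢u = apex∉rim ins ∘ inj₁
    q≢v = apex∉rim ins ∘ inj₂ ∘ inj₁
    q≢w = apex∉rim ins ∘ inj₂ ∘ inj₂

module ConvexCombination (P : PointSet) (p : Fin (n P)) (w : Fin (n P) → ℚ)
  (w≥0 : ∀ i → 0ℚ ≤ w i) (wₚ≡0 : w p ≡ 0ℚ) (∑w≡1 : ∑ (n P) w ≡ 1ℚ)
  (∑wx≡x : ∑ (n P) (λ i → w i * proj₁ (pt P i)) ≡ proj₁ (pt P p))
  (∑wy≡y : ∑ (n P) (λ i → w i * proj₂ (pt P i)) ≡ proj₂ (pt P p)) where

  open Orientation P
  open ≡-Reasoning

  ∑w·D≡0 : ∀ r → ∑ (n P) (λ i → w i * D p r i) ≡ 0ℚ
  ∑w·D≡0 r with det-affine (pt P p) (pt P r)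
  ... | A , B , C , affine = begin
    ∑ (n P) (λ i → w i * D p r i)
      ≡⟨ ∑-cong (n P) (λ i → cong (w i *_) (affine (pt P i))) ⟩
    ∑ (n P) (λ i → w i * (A * proj₁ (pt P i) + B * proj₂ (pt P i) + C))
      ≡⟨ ∑-affine (n P) w (proj₁ ∘ pt P) (proj₂ ∘ pt P) A B C ⟩
    A * ∑ (n P) (λ i → w i * proj₁ (pt P i)) + B * ∑ (n P) (λ i → w i * proj₂ (pt P i)) + C * ∑ (n P) w
      ≡⟨ cong₂ (λ X Y → A * X + B * Y + C * ∑ (n P) w) ∑wx≡x ∑wy≡y ⟩
    A * proj₁ (pt P p) + B * proj₂ (pt P p) + C * ∑ (n P) w
      ≡⟨ cong (λ S → A * proj₁ (pt P p) + B * proj₂ (pt P p) + C * S) ∑w≡1 ⟩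
    A * proj₁ (pt P p) + B * proj₂ (pt P p) + C * 1ℚ
      ≡⟨ cong (A * proj₁ (pt P p) + B * proj₂ (pt P p) +_) (*-identityʳ C) ⟩
    A * proj₁ (pt P p) + B * proj₂ (pt P p) + C
      ≡⟨ sym (affine (pt P p)) ⟩
    D p r p
      ≡⟨ det-repeat₁₃ (pt P p) (pt P r) ⟩
    0ℚ ∎

  -- If no point lies strictly left of the ray p r, all the weight sits on that line,
  -- hence (general position) on r, and then p and r share their x-coordinate.
  left-of-ray : ∀ r → p ≢ r → ∃[ i ] 0ℚ < D p r i
  left-of-ray r p≢r with Fin.any? (λ i → 0ℚ <? D p r i)
  ... | yes found = found
  ... | no  none  = ⊥-elim (distinctX P p r p≢r (sym xᵣ≡xₚ))
    where
    w·D≡0 : ∀ i → w i * D p r i ≡ 0ℚ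
    w·D≡0 = ∑-nonpos-≡0 (n P)
      (λ i → nonPositive⁻¹ _ {{nonNeg*nonPos⇒nonPos (w i) {{nonNegative (w≥0 i)}} (D p r i)
                                 {{nonPositive (≮⇒≥ (λ 0<D → none (i , 0<D)))}}}})
      (∑w·D≡0 r)
    off-r : ∀ i → i ≢ r → w i ≡ 0ℚ
    off-r i i≢r with i Fin.≟ p
    ... | yes refl = wₚ≡0
    ... | no  i≢p  = *≡0⇒≡0 (w·D≡0 i) (generalPosition P p r i p≢r (≢-sym i≢r) (≢-sym i≢p))
    wᵣ≡1 : w r ≡ 1ℚ
    wᵣ≡1 = trans (sym (∑-single (n P) {w} r off-r)) ∑w≡1
    xᵣ≡xₚ : proj₁ (pt P r) ≡ proj₁ (pt P p)
    xᵣ≡xₚ = begin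
      proj₁ (pt P r)                          ≡⟨ sym (*-identityˡ _) ⟩
      1ℚ * proj₁ (pt P r)                     ≡⟨ cong (_* proj₁ (pt P r)) (sym wᵣ≡1) ⟩
      w r * proj₁ (pt P r)                    ≡⟨ sym (∑-single (n P) r (λ i i≢r →
                                                   trans (cong (_* _) (off-r i i≢r)) (*-zeroˡ (proj₁ (pt P i))))) ⟩
      ∑ (n P) (λ i → w i * proj₁ (pt P i))    ≡⟨ ∑wx≡x ⟩
      proj₁ (pt P p)                          ∎

  other-point : ∃[ r ] p ≢ r
  other-point with Fin.any? (λ r → ¬? (p Fin.≟ r))
  ... | yes found = found
  ... | no  none  = ⊥-elim (1≢0 (begin
    1ℚ          ≡⟨ sym ∑w≡1 ⟩
    ∑ (n P) w   ≡⟨ ∑-single (n P) {w} p (λ i i≢p → ⊥-elim (none (i , ≢-sym i≢p))) ⟩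
    w p         ≡⟨ wₚ≡0 ⟩
    0ℚ          ∎))

  -- Sweep counterclockwise from r to the last point m still left of p r; the next
  -- point z left of p m then lies right of p r, and p is inside r m z.
  interior : Interior p
  interior = r , m , z , inside plus 0<Dprm 0<Dpmz 0<Dpzr
    where
    r = proj₁ other-point
    p≢r = proj₂ other-point
    sweep = maximal (λ i → 0ℚ <? D p r i) (λ a b → 0ℚ <? D p a b)
                    (λ {a} {b} {c} → left-turn-trans {pt P p} {pt P r} {pt P a} {pt P b} {pt P c})
                    (λ {a} → <-irrefl (sym (det-repeat₂₃ (pt P p) (pt P a))))
                    (proj₂ (left-of-ray r p≢r)) (allFin (n P))
    m = proj₁ sweep
    0<Dprm = proj₁ (proj₂ sweep)
    p≢m = proj₂ (proj₂ (hasSign⇒distinct {plus} 0<Dprm))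
    z = proj₁ (left-of-ray m p≢m)
    0<Dpmz = proj₂ (left-of-ray m p≢m)
    0≮Dprz : ¬ 0ℚ < D p r z
    0≮Dprz 0<Dprz = proj₂ (proj₂ sweep) (∈-allFin z) 0<Dprz 0<Dpmz
    r≢z : r ≢ z
    r≢z r≡z = <-asym (subst (λ t → 0ℚ < D p m t) (sym r≡z) 0<Dpmz)
                     (hasSign-swap₂₃ (pt P p) (pt P r) (pt P m) {plus} 0<Dprm)
    Dprz<0 : D p r z < 0ℚ
    Dprz<0 = ≢0∧≯0⇒<0 (generalPosition P p r z p≢r r≢z (proj₂ (proj₂ (hasSign⇒distinct {plus} 0<Dpmz))))
                      0≮Dprz
    0<Dpzr : 0ℚ < D p z r
    0<Dpzr = hasSign-swap₂₃ (pt P p) (pt P r) (pt P z) {minus} Dprz<0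

hull⇒interior : ∀ P {p} → InHullOfOthers P p → Orientation.Interior P p
hull⇒interior P {p} (w , w≥0 , wₚ≡0 , ∑w≡1 , ∑wx≡x , ∑wy≡y) =
  ConvexCombination.interior P p w w≥0 wₚ≡0 ∑w≡1 ∑wx≡x ∑wy≡y

module Tournament (P : PointSet) (Γ : BinPred P)
                  (lc : LocallyConsistent P Γ) (anti : Antisymmetric P Γ) where

  open Orientation P
  open ≡-Reasoning

  Γ-reverse : ∀ {x y s} → x ≢ y → Γ y x ≡ s → Γ x y ≡ opposite s
  Γ-reverse {x} {y} x≢y Γyx≡s = trans (anti x y x≢y) (cong opposite Γyx≡s)

  Γ-reverse-cong : ∀ {x y x′ y′} → x ≢ y → x′ ≢ y′ → Γ x y ≡ Γ x′ y′ → Γ y x ≡ Γ y′ x′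
  Γ-reverse-cong x≢y x′≢y′ e = trans (Γ-reverse (≢-sym x≢y) e) (sym (anti _ _ (≢-sym x′≢y′)))

  consistent : ∀ {a₁ a₂ a₃ b₁ b₂ b₃} → Distinct3 a₁ a₂ a₃ → Distinct3 b₁ b₂ b₃ →
               ¬ SameSet (a₁ , a₂ , a₃) (b₁ , b₂ , b₃) →
               Γ a₁ a₂ ≡ Γ b₁ b₂ → Γ a₂ a₃ ≡ Γ b₂ b₃ → Γ a₁ a₃ ≡ Γ b₁ b₃ →
               Δ P a₁ a₂ a₃ ≡ Δ P b₁ b₂ b₃
  consistent da@(a₁≢a₂ , a₂≢a₃ , a₁≢a₃) db@(b₁≢b₂ , b₂≢b₃ , b₁≢b₃) different e₁₂ e₂₃ e₁₃ =
    lc _ _ _ _ _ _ da db different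
       e₁₂ (Γ-reverse-cong a₁≢a₂ b₁≢b₂ e₁₂)
       e₁₃ (Γ-reverse-cong a₁≢a₃ b₁≢b₃ e₁₃)
       e₂₃ (Γ-reverse-cong a₂≢a₃ b₂≢b₃ e₂₃)

  Γ₃ : F → F → F → Pattern
  Γ₃ a b c = Γ a b , Γ b c , Γ c a

  Δₘ : F → F → F → Sign
  Δₘ a b c = majority (Γ₃ a b c) ⊛ Δ P a b c

  Δₘ-rotate : ∀ a b c → Δₘ b c a ≡ Δₘ a b c
  Δₘ-rotate a b c = cong₂ _⊛_ (majority-rotate (Γ a b) (Γ b c) (Γ c a)) (Δ-rotate a b c)

  Γ₃-swap : ∀ {a b c} → Distinct3 a b c →
            Γ₃ a c b ≡ (opposite (Γ c a) , opposite (Γ b c) , opposite (Γ a b))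
  Γ₃-swap {a} {b} {c} (a≢b , b≢c , a≢c) =
    cong₂ _,_ (anti a c a≢c) (cong₂ _,_ (anti c b (≢-sym b≢c)) (anti b a (≢-sym a≢b)))

  Δₘ-swap : ∀ {a b c} → Distinct3 a b c → Δₘ a c b ≡ Δₘ a b c
  Δₘ-swap {a} {b} {c} d = begin
    majority (Γ₃ a c b) ⊛ Δ P a c b
      ≡⟨ cong₂ _⊛_ (trans (cong majority (Γ₃-swap d)) (majority-mirror (Γ a b) (Γ b c) (Γ c a)))
                   (Δ-swap d) ⟩
    opposite (majority (Γ₃ a b c)) ⊛ opposite (Δ P a b c)
      ≡⟨ opposite[s]⊛opposite[t]≡s⊛t (majority (Γ₃ a b c)) (Δ P a b c) ⟩
    majority (Γ₃ a b c) ⊛ Δ P a b c ∎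

  cyclic-swap : ∀ {a b c} → Distinct3 a b c → cyclic (Γ₃ a c b) ≡ cyclic (Γ₃ a b c)
  cyclic-swap {a} {b} {c} d = trans (cong cyclic (Γ₃-swap d)) (cyclic-mirror (Γ a b) (Γ b c) (Γ c a))

  Δₘ-forward : ∀ {a b c} → Γ a b ≡ plus → Γ b c ≡ plus → Δₘ a b c ≡ Δ P a b c
  Δₘ-forward {a} {b} {c} Γab≡+ Γbc≡+ =
    cong (λ t → majority t ⊛ Δ P a b c) (cong₂ (λ s t → s , t , Γ c a) Γab≡+ Γbc≡+)

  record Canonical (a b c : F) : Set where
    field
      u v w    : F
      same     : SameSet (u , v , w) (a , b , c)
      distinct : Distinct3 u v w
      Γuv≡+    : Γ u v ≡ plus
      Γvw≡+    : Γ v w ≡ plus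
      Δₘ≡      : Δₘ u v w ≡ Δₘ a b c
      cyclic≡  : cyclic (Γ₃ u v w) ≡ cyclic (Γ₃ a b c)

  canonical-here : ∀ {a b c} → Distinct3 a b c → Γ a b ≡ plus → Γ b c ≡ plus → Canonical a b c
  canonical-here d Γab≡+ Γbc≡+ =
    record { same = sameSet-refl ; distinct = d ; Γuv≡+ = Γab≡+ ; Γvw≡+ = Γbc≡+
           ; Δₘ≡ = refl ; cyclic≡ = refl }

  canonical-rotate : ∀ {a b c} → Canonical b c a → Canonical a b c
  canonical-rotate {a} {b} {c} C = record
    { u = u ; v = v ; w = w ; distinct = distinct ; Γuv≡+ = Γuv≡+ ; Γvw≡+ = Γvw≡+
    ; same    = sameSet-trans same sameSet-rotate
    ; Δₘ≡     = trans Δₘ≡ (Δₘ-rotate a b c)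
    ; cyclic≡ = trans cyclic≡ (cyclic-rotate (Γ a b) (Γ b c) (Γ c a))
    }
    where open Canonical C

  canonical-swap : ∀ {a b c} → Distinct3 a b c → Canonical a c b → Canonical a b c
  canonical-swap d C = record
    { u = u ; v = v ; w = w ; distinct = distinct ; Γuv≡+ = Γuv≡+ ; Γvw≡+ = Γvw≡+
    ; same    = sameSet-trans same sameSet-swap
    ; Δₘ≡     = trans Δₘ≡ (Δₘ-swap d)
    ; cyclic≡ = trans cyclic≡ (cyclic-swap d)
    }
    where open Canonical C

  canonical : ∀ {a b c} → Distinct3 a b c → Canonical a b c
  canonical {a} {b} {c} d@(a≢b , b≢c , a≢c) with Γ a b in e₁ | Γ b c in e₂ | Γ c a in e₃
  ... | plus  | plus  | _     = canonical-here d e₁ e₂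
  ... | minus | plus  | plus  = canonical-rotate (canonical-here (≢-rotate d) e₂ e₃)
  ... | plus  | minus | plus  =
    canonical-rotate (canonical-rotate (canonical-here (≢-rotate (≢-rotate d)) e₃ e₁))
  ... | _     | minus | minus =
    canonical-swap d (canonical-here (≢-swap d) (Γ-reverse a≢c e₃) (Γ-reverse (≢-sym b≢c) e₂))
  ... | minus | plus  | minus =
    canonical-swap d (canonical-rotate (canonical-rotate
      (canonical-here (≢-rotate (≢-rotate (≢-swap d))) (Γ-reverse (≢-sym a≢b) e₁) (Γ-reverse a≢c e₃))))
  ... | minus | minus | plus  =
    canonical-swap d (canonical-rotate
      (canonical-here (≢-rotate (≢-swap d)) (Γ-reverse (≢-sym b≢c) e₂) (Γ-reverse (≢-sym a≢b) e₁)))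

  cyclic≡⇒Δₘ≡ : ∀ {a b c a′ b′ c′} → Distinct3 a b c → Distinct3 a′ b′ c′ →
              ¬ SameSet (a , b , c) (a′ , b′ , c′) →
              cyclic (Γ₃ a b c) ≡ cyclic (Γ₃ a′ b′ c′) → Δₘ a b c ≡ Δₘ a′ b′ c′
  cyclic≡⇒Δₘ≡ {a} {b} {c} {a′} {b′} {c′} d d′ different cyc≡ = begin
    Δₘ a b c        ≡⟨ sym C.Δₘ≡ ⟩
    Δₘ C.u C.v C.w  ≡⟨ Δₘ-forward C.Γuv≡+ C.Γvw≡+ ⟩
    Δ P C.u C.v C.w ≡⟨ consistent C.distinct C′.distinct different′
                         (trans C.Γuv≡+ (sym C′.Γuv≡+)) (trans C.Γvw≡+ (sym C′.Γvw≡+)) Γuw≡ ⟩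
    Δ P C′.u C′.v C′.w ≡⟨ sym (Δₘ-forward C′.Γuv≡+ C′.Γvw≡+) ⟩
    Δₘ C′.u C′.v C′.w  ≡⟨ C′.Δₘ≡ ⟩
    Δₘ a′ b′ c′     ∎
    where
    module C  = Canonical (canonical d)
    module C′ = Canonical (canonical d′)
    different′ : ¬ SameSet (C.u , C.v , C.w) (C′.u , C′.v , C′.w)
    different′ same = different (sameSet-trans (sameSet-sym C.same) (sameSet-trans same C′.same))
    Γwu≡ : Γ C.w C.u ≡ Γ C′.w C′.u
    Γwu≡ = cyclic[+,+,s]-injective _ _ (begin
      cyclic (plus , plus , Γ C.w C.u)   ≡⟨ cong₂ (λ s t → cyclic (s , t , Γ C.w C.u)) (sym C.Γuv≡+) (sym C.Γvw≡+) ⟩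
      cyclic (Γ₃ C.u C.v C.w)            ≡⟨ trans C.cyclic≡ (trans cyc≡ (sym C′.cyclic≡)) ⟩
      cyclic (Γ₃ C′.u C′.v C′.w)         ≡⟨ cong₂ (λ s t → cyclic (s , t , Γ C′.w C′.u)) C′.Γuv≡+ C′.Γvw≡+ ⟩
      cyclic (plus , plus , Γ C′.w C′.u) ∎)
    Γuw≡ : Γ C.u C.w ≡ Γ C′.u C′.w
    Γuw≡ = Γ-reverse-cong (≢-sym (proj₂ (proj₂ C.distinct))) (≢-sym (proj₂ (proj₂ C′.distinct))) Γwu≡

  coherent : ∀ {a b c a′ b′ c′} → Distinct3 a b c → Distinct3 a′ b′ c′ →
             ¬ SameSet (a , b , c) (a′ , b′ , c′) → Δ P a b c ≡ Δ P a′ b′ c′ →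
             Coherent (Γ₃ a b c) (Γ₃ a′ b′ c′)
  coherent {a} {b} {c} {a′} {b′} {c′} d d′ different Δ≡ cyc≡ =
    Sign.*-cancelʳ-≡ (Δ P a′ b′ c′) _ _
      (trans (cong (majority (Γ₃ a b c) ⊛_) (sym Δ≡)) (cyclic≡⇒Δₘ≡ d d′ different cyc≡))

  Γ₃-reverse-last : ∀ {a b c} → a ≢ c → Γ₃ a b c ≡ (Γ a b , Γ b c , opposite (Γ a c))
  Γ₃-reverse-last {a} {b} {c} a≢c = cong (λ s → Γ a b , Γ b c , s) (Γ-reverse (≢-sym a≢c) refl)

  record Spokes (p r x z : F) : Set where
    field
      Γpr≡Γpx      : Γ p r ≡ Γ p x
      Γpx≡Γpz      : Γ p x ≡ Γ p z
      rim-cyclic   : cyclic (Γ₃ r x z) ≡ true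
      Δₘ-spoke≡rim : Δₘ p r x ≡ Δₘ r x z

  spokes : ∀ {p r x z} → InTriangle p r x z → Spokes p r x z
  spokes {p} {r} {x} {z} ins@(inside ε prx pxz pzr) =
    let Γpr≡Γpx , Γpx≡Γpz , rim-cyclic , majority≡ =
          wheel-patterns (Γ p r) (Γ p x) (Γ p z) (Γ r x) (Γ x z) (Γ z r)
            ( coh prx pxz (apart at₂ (rim∉ ins)) T₁ T₂
            , coh prx pzr (apart at₃ (rim∉ (inside-rotate ins))) T₁ T₃
            , coh prx rxz (apart at₁ (apex∉rim ins)) T₁ refl
            , coh pxz pzr (apart at₂ (rim∉ (inside-rotate ins))) T₂ T₃
            , coh pxz rxz (apart at₁ (apex∉rim ins)) T₂ refl
            , coh pzr rxz (apart at₁ (apex∉rim ins)) T₃ refl )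
    in record
      { Γpr≡Γpx = Γpr≡Γpx ; Γpx≡Γpz = Γpx≡Γpz ; rim-cyclic = rim-cyclic
      ; Δₘ-spoke≡rim = cong₂ _⊛_ (trans (cong majority T₁) majority≡)
                                 (trans (signOf-hasSign ε prx) (sym (signOf-hasSign ε rxz))) }
    where
    rxz = inside-outer ins
    T₁ = Γ₃-reverse-last {b = r} (apex∉rim ins ∘ inj₂ ∘ inj₁)
    T₂ = Γ₃-reverse-last {b = x} (apex∉rim ins ∘ inj₂ ∘ inj₂)
    T₃ = Γ₃-reverse-last {b = z} (apex∉rim ins ∘ inj₁)
    coh : ∀ {a b c a′ b′ c′ t t′} → HasSign ε (D a b c) → HasSign ε (D a′ b′ c′) →
          ¬ SameSet (a , b , c) (a′ , b′ , c′) → Γ₃ a b c ≡ t → Γ₃ a′ b′ c′ ≡ t′ → Coherent t t′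
    coh {a} {b} {c} {a′} {b′} {c′} h h′ different refl refl =
      coherent (hasSign⇒distinct {a = a} h) (hasSign⇒distinct {a = a′} h′) different
               (trans (signOf-hasSign ε h) (sym (signOf-hasSign ε h′)))

  fan-orientation : ∀ {p r x z a b} → InTriangle p r x z → Distinct3 p a b → ¬ b ∈₃ (p , r , x) →
                    Γ p a ≡ Γ p r → Γ b p ≡ Γ p r → Γ p r ⊛ Δ P p a b ≡ Δₘ r x z
  fan-orientation {p} {r} {x} {z} {a} {b} ins d b∉prx Γpa≡s Γbp≡s =
    trans (sym Δₘ-fan) (by-cyclicity (cyclic (Γ₃ p a b)) refl)
    where
    open Spokes (spokes ins)
    s = Γ p r
    Δₘ-fan : Δₘ p a b ≡ s ⊛ Δ P p a b
    Δₘ-fan = cong (_⊛ Δ P p a b)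
      (trans (cong majority (cong₂ (λ u v → u , Γ a b , v) Γpa≡s Γbp≡s)) (majority[s,t,s]≡s s (Γ a b)))
    spoke-acyclic : cyclic (Γ₃ p r x) ≡ false
    spoke-acyclic = trans (cong cyclic (Γ₃-reverse-last {b = r} (apex∉rim ins ∘ inj₂ ∘ inj₁)))
      (trans (cong (λ t → cyclic (s , Γ r x , opposite t)) (sym Γpr≡Γpx)) (cyclic[s,t,-s]≡false s (Γ r x)))
    by-cyclicity : ∀ β → cyclic (Γ₃ p a b) ≡ β → Δₘ p a b ≡ Δₘ r x z
    by-cyclicity true  cyc = cyclic≡⇒Δₘ≡ d (hasSign⇒distinct {a = r} (inside-outer ins))
                                       (apart at₁ (apex∉rim ins)) (trans cyc (sym rim-cyclic))
    by-cyclicity false cyc = trans (cyclic≡⇒Δₘ≡ d (hasSign⇒distinct (Inside.prx ins)) (apart at₃ b∉prx)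
                                              (trans cyc (sym spoke-acyclic)))
                                   Δₘ-spoke≡rim

  -- If Γ p b went against the spokes, every triangle p a b (a = r, x, z) would have
  -- the same Δₘ, so b would lie on the same side of the three spokes.
  interior-uniform : ∀ {p r x z} → InTriangle p r x z → ∀ b → p ≢ b → Γ p b ≡ Γ p r
  interior-uniform {p} {r} {x} {z} ins b p≢b with Γ p b Sign.≟ Γ p r
  ... | yes Γpb≡Γpr = Γpb≡Γpr
  ... | no  Γpb≢Γpr =
    ⊥-elim (no-half-plane ins p≢b r≢b x≢b z≢b
             (fans-agree p≢r refl r≢b p≢x Γpx≡Γpr x≢b) (fans-agree p≢x Γpx≡Γpr x≢b p≢z Γpz≡Γpr z≢b))
    where
    open Spokes (spokes ins)
    p≢r = apex∉rim ins ∘ inj₁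
    p≢x = apex∉rim ins ∘ inj₂ ∘ inj₁
    p≢z = apex∉rim ins ∘ inj₂ ∘ inj₂
    Γpx≡Γpr = sym Γpr≡Γpx
    Γpz≡Γpr = sym (trans Γpr≡Γpx Γpx≡Γpz)
    ≢b : ∀ {a} → Γ p a ≡ Γ p r → a ≢ b
    ≢b Γpa≡Γpr a≡b = Γpb≢Γpr (trans (cong (Γ p) (sym a≡b)) Γpa≡Γpr)
    r≢b = ≢b refl
    x≢b = ≢b Γpx≡Γpr
    z≢b = ≢b Γpz≡Γpr
    Γbp≡Γpr : Γ b p ≡ Γ p r
    Γbp≡Γpr = trans (Γ-reverse (≢-sym p≢b) refl) (s≢t⇒opposite[s]≡t Γpb≢Γpr)
    fans-agree : ∀ {a a′} → p ≢ a → Γ p a ≡ Γ p r → a ≢ b → p ≢ a′ → Γ p a′ ≡ Γ p r → a′ ≢ b →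
                 Δ P p a b ≡ Δ P p a′ b
    fans-agree p≢a Γpa≡Γpr a≢b p≢a′ Γpa′≡Γpr a′≢b = Sign.*-cancelˡ-≡ (Γ p r) _ _ (trans
      (fan-orientation ins (p≢a , a≢b , p≢b) b∉prx Γpa≡Γpr Γbp≡Γpr)
      (sym (fan-orientation ins (p≢a′ , a′≢b , p≢b) b∉prx Γpa′≡Γpr Γbp≡Γpr)))
      where b∉prx = ∉₃ (≢-sym p≢b) (≢-sym r≢b) (≢-sym x≢b)

  SourceOrSink : F → Set
  SourceOrSink p = ∀ b c → p ≢ b → p ≢ c → Γ p b ≡ Γ p c

  interior⇒source-or-sink : ∀ {p} → Interior p → SourceOrSink p
  interior⇒source-or-sink (_ , _ , _ , ins) b c p≢b p≢c =
    trans (interior-uniform ins b p≢b) (sym (interior-uniform ins c p≢c))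

  source-or-sink⇒one-sided : ∀ {p q} → q ≢ p → SourceOrSink p → SourceOrSink q → AllOnOneSide q p
  source-or-sink⇒one-sided {p} {q} q≢p p-uniform q-uniform a a′ q≢a a≢p q≢a′ a′≢p with a Fin.≟ a′
  ... | yes refl = refl
  ... | no  a≢a′ =
    consistent (q≢a , a≢p , q≢p) (q≢a′ , a′≢p , q≢p) (apart at₂ (∉₃ (≢-sym q≢a) a≢a′ a≢p))
      (q-uniform a a′ q≢a q≢a′)
      (Γ-reverse-cong (≢-sym a≢p) (≢-sym a′≢p) (p-uniform a a′ (≢-sym a≢p) (≢-sym a′≢p)))
      refl

  at-most-one-interior : ∀ {p q} → p ≢ q → Interior p → Interior q → ⊥
  at-most-one-interior p≢q int-p int-q@(_ , _ , _ , ins) =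
    interior-splits ins q≢p
      (source-or-sink⇒one-sided q≢p (interior⇒source-or-sink int-p) (interior⇒source-or-sink int-q))
    where q≢p = ≢-sym p≢q

all-but-one : ∀ {N} {E B : Fin N → Set} → (∀ i → Dec (B i)) → (∀ i → ¬ B i → E i) →
              (∀ {i j} → i ≢ j → B i → B j → ⊥) →
              Σ (List (Fin N)) λ S → Unique S × All E S × N ∸ 1 ≤ℕ length S
all-but-one {N} B? ¬B⇒E at-most-one with Fin.any? B?
... | no none = allFin N , Unique.allFin⁺ N , All.tabulate⁺ (λ i → ¬B⇒E i (λ Bi → none (i , Bi))) ,
                subst (N ∸ 1 ≤ℕ_) (sym (length-tabulate {n = N} (λ i → i))) (ℕ.m∸n≤m N 1)
... | yes (i₀ , Bi₀) = others i₀ (λ j j≢i₀ → ¬B⇒E j (λ Bj → at-most-one j≢i₀ Bj Bi₀))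
  where
  others : ∀ {N} {E : Fin N → Set} (i₀ : Fin N) → (∀ j → j ≢ i₀ → E j) →
           Σ (List (Fin N)) λ S → Unique S × All E S × N ∸ 1 ≤ℕ length S
  others {suc N} i₀ E-off-i₀ = tabulate (punchIn i₀) ,
    Unique.tabulate⁺ (λ {j} {k} → Fin.punchIn-injective i₀ j k) ,
    All.tabulate⁺ (λ j → E-off-i₀ _ (Fin.punchInᵢ≢i i₀ j)) ,
    ℕ.≤-reflexive (sym (length-tabulate (punchIn i₀)))

proposition2 : (P : PointSet) (Γ : BinPred P) →
               LocallyConsistent P Γ → Antisymmetric P Γ → WheelSet P
proposition2 P Γ lc anti =
  all-but-one (interior? P) (λ _ ¬interior hull → ¬interior (hull⇒interior P hull))
              (Tournament.at-most-one-interior P Γ lc anti)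
  where open Orientation
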